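{- Let $\Pi^{(2)}$ be the set of $3$-nonnesting open partition diagrams, and to each $\pi\in\Pi^{(2)}$ associate the label $\ell(\pi)=[i,j]$, where $i$ is the number of semi-arcs of $\pi$ and $j$ is the number of semi-arcs of $\pi$ that belong to some future $2$-nesting of $\pi$. Consider the generating tree with root label $[0,0]$ and succession rule \[ [i,j]\rightarrow \begin{cases} [i,j] & \text{(always)},\\ [i+1,j] & \text{(always)},\\ [i,m] \text{ for each } m \text{ with } j\le m\le i-1 & \text{if } i\ge 1,\\ [i-1,m] \text{ for each } m \text{ with } j\le m\le i-1 & \text{if } i\ge 1,\\ [i,j-1],\ [i-1,j-1] & \text{if } i\ge 1 \text{ and } j>0. \end{cases} \] Then for every $n\ge 0$, the number of diagrams in $\Pi^{(2)}$ of size $n$ equals the number of nodes at level $n$ of this generating tree. Moreover, the number of $3$-nonnesting set partitions of $\{1,\dots,n\}$ is equal to the number of nodes with label $[0,0]$ at level $n$.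
   Context: An open partition diagram of size $n\ge 0$ consists of vertices $1,\dots,n$ placed in a row, together with a set of arcs $(a,b)$ with $1\le a<b\le n$ and a set of semi-arcs $(a,*)$ with $1\le a\le n$ (a semi-arc has a left end-point but no right end-point; it is drawn continuing to the right of vertex $n$, semi-arcs not crossing one another), such that every vertex is the left end-point of at most one arc or semi-arc and the right end-point of at most one arc. Equivalently, it is a set partition of $\{1,\dots,n\}$ in which each block is marked "closed" or "open": a block $\{a_1<\dots<a_r\}$ contributes the arcs $(a_1,a_2),\dots,(a_{r-1},a_r)$, and, if marked open, also the semi-arc $(a_r,*)$. A set partition of $\{1,\dots,n\}$ is identified with the open partition diagram having no semi-arcs. A $k$-nesting is a set of $k$ arcs $(i_1,j_1),\dots,(i_k,j_k)$ with $i_1<i_2<\dots<i_k<j_k<\dots<j_1$. A future $k$-nesting is a $(k-1)$-nesting $(i_2,j_2),\dots,(i_k,j_k)$ together with a semi-arc $(i_1,*)$ with $i_1<i_2$. An open partition diagram is $k$-nonnesting if it contains neither a $k$-nesting nor a future $k$-nesting. A generating tree with root label $L_0$ and a succession rule (assigning to each label a finite list of labels, with multiplicity) is the rooted tree whose root, at level $0$, has label $L_0$, and in which each node with label $L$ has exactly one child for each entry of the list assigned to $L$, labelled by that entry; level $n$ consists of the nodes at distance $n$ from the root. -}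

module Defs where

open import Data.Nat using (ℕ; zero; suc; _+_; _∸_)
open import Data.Fin using (Fin; _<_)
open import Data.Vec using (Vec; lookup)
open import Data.List using (List; []; _∷_; length; map; concatMap; upTo; filter; _++_)
open import Data.List.Membership.Propositional using (_∈_)
open import Data.List.Relation.Unary.Unique.Propositional using (Unique)
open import Data.Product using (Σ; _×_; _,_; ∃-syntax)
open import Relation.Binary.PropositionalEquality using (_≡_; _≢_)
open import Relation.Nullary using (¬_)
open import Function.Bundles using (_⇔_)
import Data.Product.Properties as PP
open import Data.Nat.Properties using (_≟_)

-- Each vertex a ∈ Fin n (vertex a+1 in the paper) is the left end-point of
-- at most one arc or semi-arc; we record what starts at a:
--   none    : nothing starts at a
--   semi    : the semi-arc (a,*)
--   arc b   : the arc (a,b)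

data Out (n : ℕ) : Set where
  none : Out n
  semi : Out n
  arc  : Fin n → Out n

Diagram : ℕ → Set
Diagram n = Vec (Out n) n

module _ {n : ℕ} (d : Diagram n) where

  IsArc : Fin n → Fin n → Set
  IsArc a b = lookup d a ≡ arc b

  IsSemi : Fin n → Set
  IsSemi a = lookup d a ≡ semi

  WellFormed : Set
  WellFormed =
    (∀ a b → IsArc a b → a < b) ×
    (∀ a a' b → IsArc a b → IsArc a' b → a ≡ a')

  Has3Nesting : Set
  Has3Nesting = ∃[ i₁ ] ∃[ i₂ ] ∃[ i₃ ] ∃[ j₃ ] ∃[ j₂ ] ∃[ j₁ ]
    (i₁ < i₂ × i₂ < i₃ × i₃ < j₃ × j₃ < j₂ × j₂ < j₁ ×
     IsArc i₁ j₁ × IsArc i₂ j₂ × IsArc i₃ j₃)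

  HasFuture3Nesting : Set
  HasFuture3Nesting = ∃[ i₁ ] ∃[ i₂ ] ∃[ i₃ ] ∃[ j₃ ] ∃[ j₂ ]
    (i₁ < i₂ × i₂ < i₃ × i₃ < j₃ × j₃ < j₂ ×
     IsSemi i₁ × IsArc i₂ j₂ × IsArc i₃ j₃)

  ThreeNonnesting : Set
  ThreeNonnesting = ¬ Has3Nesting × ¬ HasFuture3Nesting

  NoSemiArcs : Set
  NoSemiArcs = ∀ a → ¬ IsSemi a

InPi2 : ∀ {n} → Diagram n → Set
InPi2 d = WellFormed d × ThreeNonnesting d

Is3NonnestingSetPartition : ∀ {n} → Diagram n → Set
Is3NonnestingSetPartition d = WellFormed d × NoSemiArcs d × ¬ Has3Nesting d

HasCard : {A : Set} → (A → Set) → ℕ → Set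
HasCard {A} P k = Σ (List A) λ L →
  Unique L × (∀ x → (x ∈ L) ⇔ P x) × length L ≡ k

Label : Set
Label = ℕ × ℕ

range : ℕ → ℕ → List ℕ
range j i = map (j +_) (upTo (i ∸ j))

rule : Label → List Label
rule (zero , j) = (zero , j) ∷ (1 , j) ∷ []
rule (suc i' , j) =
  (suc i' , j) ∷ (suc (suc i') , j) ∷
  (map (λ m → (suc i' , m)) (range j (suc i')) ++
   map (λ m → (i' , m)) (range j (suc i')) ++
   extra j)
  where
  extra : ℕ → List Label
  extra zero = []
  extra (suc j') = (suc i' , j') ∷ (i' , j') ∷ []

levelLabels : ℕ → List Label
levelLabels zero = (0 , 0) ∷ []
levelLabels (suc n) = concatMap rule (levelLabels n)

nodesAtLevel : ℕ → ℕ
nodesAtLevel n = length (levelLabels n)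

nodesLabel00AtLevel : ℕ → ℕ
nodesLabel00AtLevel n =
  length (filter (λ l → PP.≡-dec _≟_ _≟_ l (0 , 0)) (levelLabels n))

module Submission where

open import Defs
open import Data.Nat as ℕ using (ℕ; zero; suc; _+_; _<_; _≤_)
import Data.Nat.Properties as NP
open import Data.Fin using (Fin; toℕ; fromℕ; inject₁)
open import Data.Fin.Properties as FP using (toℕ-injective; toℕ<n; toℕ-fromℕ; toℕ-inject₁)
open import Data.Fin.Relation.Unary.Top using (View; view; ‵fromℕ; ‵inject₁; view-fromℕ; view-inject₁)
open import Data.Vec as V using (Vec; lookup; tabulate)
open import Data.Vec.Properties using (lookup∘tabulate)
open import Data.Vec.Relation.Binary.Pointwise.Extensional using (Pointwise-≡⇒≡; ext)
open import Data.List as L using (List; []; _∷_; length; map; concatMap; applyUpTo; filter; _++_)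
import Data.List.Properties as LP
open import Data.List.Relation.Unary.All as All using (All; []; _∷_)
open import Data.List.Relation.Unary.AllPairs as AP using (AllPairs; []; _∷_)
import Data.List.Relation.Unary.AllPairs.Properties as APP
open import Data.List.Relation.Unary.Any using (here; there)
open import Data.List.Relation.Unary.Unique.Propositional using (Unique)
import Data.List.Relation.Unary.Unique.Propositional.Properties as UP
open import Data.List.Membership.Propositional using (_∈_; _∉_; find; lose)
open import Data.List.Membership.Propositional.Properties
open import Data.Maybe using (Maybe; just; nothing)
import Data.Maybe.Properties as MP
open import Data.Bool using (Bool; true; false; if_then_else_)
open import Data.Product hiding (map)
open import Data.Sum hiding (map)
open import Data.Empty
import Data.Product.Properties as PP
open import Relation.Binary.PropositionalEquality
open import Relation.Nullary
open import Relation.Unary using (Decidable)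
open import Function.Base using (_∘_; case_of_)
open import Function.Bundles using (_⇔_; mk⇔; Equivalence)
import Function.Properties.Equivalence as ⇔

-- A diagram of size n+1 is obtained from one of size n (its restriction) by adding
-- the vertex n, which may close one semi-arc into an arc ending at n and may open a new
-- semi-arc. Call a semi-arc s blocked if some arc starts to the right of s (so s is the outer
-- arc of a future 2-nesting) and free otherwise. In a 3-nonnesting diagram every blocked
-- semi-arc lies to the left of every free one, and exactly the following closings keep the
-- diagram 3-nonnesting: none, any free semi-arc, or the leftmost blocked semi-arc. Closing
-- the k-th free semi-arc blocks the k-1 free semi-arcs to its left. Recording the semi-arcs as
-- the increasing lists B (blocked) and F (free), the label [|B|+|F|, |B|] of each extension is
-- precisely the corresponding entry of the succession rule, so building all diagrams level by
-- level reproduces the generating tree node by node. The nodes labelled [0,0] are the diagrams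
-- without semi-arcs, i.e. the 3-nonnesting set partitions.

opening : ∀ {m} → Bool → Out m
opening false = none
opening true  = semi

injectOut : ∀ {n} → Out n → Out (suc n)
injectOut none    = none
injectOut semi    = semi
injectOut (arc b) = arc (inject₁ b)

-- A closing `just s` closes the semi-arc starting at vertex s into an arc ending at the new
-- vertex; it is only meaningful when d has a semi-arc at s.
extendOld : ∀ {n} → Diagram n → Maybe ℕ → Fin n → Out (suc n)
extendOld d nothing a = injectOut (lookup d a)
extendOld {n} d (just s) a with s ℕ.≟ toℕ a
... | yes _ = arc (fromℕ n)
... | no  _ = injectOut (lookup d a)

extendAt : ∀ {n} → Diagram n → Maybe ℕ → Bool → {i : Fin (suc n)} → View i → Out (suc n)
extendAt d c o ‵fromℕ       = opening o
extendAt d c o (‵inject₁ a) = extendOld d c a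

extend : ∀ {n} → Diagram n → Maybe ℕ → Bool → Diagram (suc n)
extend d c o = tabulate (λ i → extendAt d c o (view i))

lookup-extend-last : ∀ {n} (d : Diagram n) c o → lookup (extend d c o) (fromℕ n) ≡ opening o
lookup-extend-last {n} d c o =
  trans (lookup∘tabulate (λ i → extendAt d c o (view i)) (fromℕ n)) (cong (extendAt d c o) (view-fromℕ n))

lookup-extend-inject₁ : ∀ {n} (d : Diagram n) c o a → lookup (extend d c o) (inject₁ a) ≡ extendOld d c a
lookup-extend-inject₁ d c o a =
  trans (lookup∘tabulate (λ i → extendAt d c o (view i)) (inject₁ a)) (cong (extendAt d c o) (view-inject₁ a))

extendOld-closed : ∀ {n} (d : Diagram n) a → extendOld d (just (toℕ a)) a ≡ arc (fromℕ n)
extendOld-closed d a with toℕ a ℕ.≟ toℕ a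
... | yes _ = refl
... | no ¬p = ⊥-elim (¬p refl)

extendOld-kept : ∀ {n} (d : Diagram n) c a → c ≢ just (toℕ a) → extendOld d c a ≡ injectOut (lookup d a)
extendOld-kept d nothing  a _ = refl
extendOld-kept d (just s) a c≢a with s ℕ.≟ toℕ a
... | yes refl = ⊥-elim (c≢a refl)
... | no  _    = refl

cutArc : ∀ {n} {b : Fin (suc n)} → View b → Out n
cutArc ‵fromℕ       = semi
cutArc (‵inject₁ a) = arc a

cutOut : ∀ {n} → Out (suc n) → Out n
cutOut none    = none
cutOut semi    = semi
cutOut (arc b) = cutArc (view b)

restrict : ∀ {n} → Diagram (suc n) → Diagram n
restrict d = tabulate (λ a → cutOut (lookup d (inject₁ a)))

lookup-restrict : ∀ {n} (d : Diagram (suc n)) a → lookup (restrict d) a ≡ cutOut (lookup d (inject₁ a))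
lookup-restrict d = lookup∘tabulate (λ a → cutOut (lookup d (inject₁ a)))

cutOut-injectOut : ∀ {n} (z : Out n) → cutOut (injectOut z) ≡ z
cutOut-injectOut none    = refl
cutOut-injectOut semi    = refl
cutOut-injectOut (arc b) = cong cutArc (view-inject₁ b)

injectOut-cutOut : ∀ {n} (z : Out (suc n)) → z ≢ arc (fromℕ n) → injectOut (cutOut z) ≡ z
injectOut-cutOut none    _ = refl
injectOut-cutOut semi    _ = refl
injectOut-cutOut (arc b) z≢last with view b
... | ‵fromℕ     = ⊥-elim (z≢last refl)
... | ‵inject₁ _ = refl

cutOut-arc⁻ : ∀ {n} (z : Out (suc n)) {b : Fin n} → cutOut z ≡ arc b → z ≡ arc (inject₁ b)
cutOut-arc⁻ (arc b′) eq with view b′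
cutOut-arc⁻ (arc _) refl | ‵inject₁ _ = refl

cutOut-semi⁻ : ∀ {n} (z : Out (suc n)) → cutOut z ≡ semi → z ≡ semi ⊎ z ≡ arc (fromℕ n)
cutOut-semi⁻ semi    _  = inj₁ refl
cutOut-semi⁻ (arc b) eq with view b
cutOut-semi⁻ (arc _) refl | ‵fromℕ = inj₂ refl

_≟Out_ : ∀ {n} (x y : Out n) → Dec (x ≡ y)
none  ≟Out none  = yes refl
none  ≟Out semi  = no λ ()
none  ≟Out arc _ = no λ ()
semi  ≟Out none  = no λ ()
semi  ≟Out semi  = yes refl
semi  ≟Out arc _ = no λ ()
arc _ ≟Out none  = no λ ()
arc _ ≟Out semi  = no λ ()
arc a ≟Out arc b with a FP.≟ b
... | yes refl = yes refl
... | no  a≢b  = no λ { refl → a≢b refl }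

vec-ext : ∀ {A : Set} {n} {xs ys : Vec A n} → (∀ i → lookup xs i ≡ lookup ys i) → xs ≡ ys
vec-ext eq = Pointwise-≡⇒≡ (ext eq)

-- Arcs and semi-arcs addressed by the ℕ-values of their end-points, so that they can be
-- compared across diagrams of different sizes.
module _ {n : ℕ} (d : Diagram n) where
  data Arc (x y : ℕ) : Set where
    arcAt : (a b : Fin n) → toℕ a ≡ x → toℕ b ≡ y → IsArc d a b → Arc x y

  data Semi (x : ℕ) : Set where
    semiAt : (a : Fin n) → toℕ a ≡ x → IsSemi d a → Semi x

  ArcStartsAfter : ℕ → Set
  ArcStartsAfter x = ∃[ y ] ∃[ z ] x < y × Arc y z

  data Nesting₃ : Set where
    nesting₃ : ∀ {x₁ x₂ x₃ y₃ y₂ y₁} → x₁ < x₂ → x₂ < x₃ → x₃ < y₃ → y₃ < y₂ → y₂ < y₁ →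
               Arc x₁ y₁ → Arc x₂ y₂ → Arc x₃ y₃ → Nesting₃

  data FutureNesting₃ : Set where
    futureNesting₃ : ∀ {x₁ x₂ x₃ y₃ y₂} → x₁ < x₂ → x₂ < x₃ → x₃ < y₃ → y₃ < y₂ →
                     Semi x₁ → Arc x₂ y₂ → Arc x₃ y₃ → FutureNesting₃

  WellFormedℕ : Set
  WellFormedℕ = (∀ x y → Arc x y → x < y) × (∀ x x′ y → Arc x y → Arc x′ y → x ≡ x′)

  Valid : Set
  Valid = WellFormedℕ × ¬ Nesting₃ × ¬ FutureNesting₃

module _ {n : ℕ} {d : Diagram n} where
  Arc-start<n : ∀ {x y} → Arc d x y → x < n
  Arc-start<n (arcAt a _ refl _ _) = toℕ<n a

  Arc-end<n : ∀ {x y} → Arc d x y → y < n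
  Arc-end<n (arcAt _ b _ refl _) = toℕ<n b

  Semi<n : ∀ {x} → Semi d x → x < n
  Semi<n (semiAt a refl _) = toℕ<n a

  Semi-Arc-disjoint : ∀ {x y} → Semi d x → Arc d x y → ⊥
  Semi-Arc-disjoint (semiAt a refl e) (arcAt _ _ a′≡a _ e′) with toℕ-injective a′≡a
  ... | refl with trans (sym e) e′
  ... | ()

IsArc⇒Arc : ∀ {n} {d : Diagram n} {a b} → IsArc d a b → Arc d (toℕ a) (toℕ b)
IsArc⇒Arc = arcAt _ _ refl refl

IsSemi⇒Semi : ∀ {n} {d : Diagram n} {a} → IsSemi d a → Semi d (toℕ a)
IsSemi⇒Semi = semiAt _ refl

InPi2⇒Valid : ∀ {n} (d : Diagram n) → InPi2 d → Valid d
InPi2⇒Valid d ((arcs-forward , ends-unique) , no-nesting , no-future) =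
  ((λ { _ _ (arcAt a b refl refl e) → arcs-forward a b e }) ,
   (λ { _ _ _ (arcAt a b refl refl e) (arcAt a′ _ refl b′≡b e′) →
        cong toℕ (ends-unique a a′ b e (subst (IsArc d a′) (toℕ-injective b′≡b) e′)) })) ,
  (λ { (nesting₃ p₁ p₂ p₃ p₄ p₅ (arcAt a₁ b₁ refl refl e₁) (arcAt a₂ b₂ refl refl e₂)
                                (arcAt a₃ b₃ refl refl e₃)) →
       no-nesting (a₁ , a₂ , a₃ , b₃ , b₂ , b₁ , p₁ , p₂ , p₃ , p₄ , p₅ , e₁ , e₂ , e₃) }) ,
  (λ { (futureNesting₃ p₁ p₂ p₃ p₄ (semiAt a₁ refl e₁) (arcAt a₂ b₂ refl refl e₂)
                                   (arcAt a₃ b₃ refl refl e₃)) →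
       no-future (a₁ , a₂ , a₃ , b₃ , b₂ , p₁ , p₂ , p₃ , p₄ , e₁ , e₂ , e₃) })

Valid⇒InPi2 : ∀ {n} (d : Diagram n) → Valid d → InPi2 d
Valid⇒InPi2 d ((arcs-forward , ends-unique) , no-nesting , no-future) =
  ((λ _ _ e → arcs-forward _ _ (IsArc⇒Arc e)) ,
   (λ _ _ _ e e′ → toℕ-injective (ends-unique _ _ _ (IsArc⇒Arc e) (IsArc⇒Arc e′)))) ,
  (λ { (_ , _ , _ , _ , _ , _ , p₁ , p₂ , p₃ , p₄ , p₅ , e₁ , e₂ , e₃) →
       no-nesting (nesting₃ p₁ p₂ p₃ p₄ p₅ (IsArc⇒Arc e₁) (IsArc⇒Arc e₂) (IsArc⇒Arc e₃)) }) ,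
  (λ { (_ , _ , _ , _ , _ , p₁ , p₂ , p₃ , p₄ , e₁ , e₂ , e₃) →
       no-future (futureNesting₃ p₁ p₂ p₃ p₄ (IsSemi⇒Semi e₁) (IsArc⇒Arc e₂) (IsArc⇒Arc e₃)) })

injectOut-arc⁻ : ∀ {n} (z : Out n) {j : Fin (suc n)} → injectOut z ≡ arc j → ∃[ b ] z ≡ arc b × j ≡ inject₁ b
injectOut-arc⁻ (arc b) refl = b , refl , refl

injectOut-semi⁻ : ∀ {n} (z : Out n) → injectOut z ≡ semi → z ≡ semi
injectOut-semi⁻ semi refl = refl

opening≢arc : ∀ {m} o {j : Fin m} → opening o ≢ arc j
opening≢arc false ()
opening≢arc true  ()

opening-semi⁻ : ∀ {m} o → opening {m} o ≡ semi → o ≡ true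
opening-semi⁻ true  _ = refl
opening-semi⁻ false ()

opening-injective : ∀ {m} o o′ → opening {m} o ≡ opening o′ → o ≡ o′
opening-injective false false _ = refl
opening-injective true  true  _ = refl
opening-injective false true  ()
opening-injective true  false ()

just-injective : ∀ {x y : ℕ} → just x ≡ just y → x ≡ y
just-injective refl = refl

arc-injective : ∀ {n} {u v : Fin n} → arc u ≡ arc v → u ≡ v
arc-injective refl = refl

closes? : ∀ {n} (c : Maybe ℕ) (a : Fin n) → Dec (c ≡ just (toℕ a))
closes? c a = MP.≡-dec ℕ._≟_ c (just (toℕ a))

module ExtendView {n : ℕ} (d : Diagram n) (c : Maybe ℕ) (o : Bool) where
  extendOld-arc⁻ : ∀ a {j} → extendOld d c a ≡ arc j →
                   (c ≡ just (toℕ a) × toℕ j ≡ n × toℕ a < n) ⊎ Arc d (toℕ a) (toℕ j)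
  extendOld-arc⁻ a e with closes? c a
  ... | yes refl = inj₁ (refl , trans (cong toℕ (sym (arc-injective (trans (sym (extendOld-closed d a)) e))))
                                      (toℕ-fromℕ n) , toℕ<n a)
  ... | no c≢a with injectOut-arc⁻ (lookup d a) (trans (sym (extendOld-kept d c a c≢a)) e)
  ...   | b , eb , refl = inj₂ (arcAt a b refl (sym (toℕ-inject₁ b)) eb)

  extendOld-semi⁻ : ∀ a → extendOld d c a ≡ semi → IsSemi d a × c ≢ just (toℕ a)
  extendOld-semi⁻ a e with closes? c a
  ... | yes refl with trans (sym (extendOld-closed d a)) e
  ...   | ()
  extendOld-semi⁻ a e | no c≢a =
    injectOut-semi⁻ (lookup d a) (trans (sym (extendOld-kept d c a c≢a)) e) , c≢a

  Arc-extend⁻ : ∀ {x y} → Arc (extend d c o) x y → (c ≡ just x × y ≡ n × x < n) ⊎ Arc d x y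
  Arc-extend⁻ (arcAt i j refl refl e) with view i
  ... | ‵fromℕ = ⊥-elim (opening≢arc o (trans (sym (lookup-extend-last d c o)) e))
  ... | ‵inject₁ a rewrite toℕ-inject₁ a = extendOld-arc⁻ a (trans (sym (lookup-extend-inject₁ d c o a)) e)

  Arc-extend⁺ : ∀ {x y} → Arc d x y → c ≢ just x → Arc (extend d c o) x y
  Arc-extend⁺ (arcAt a b refl refl e) c≢a =
    arcAt (inject₁ a) (inject₁ b) (toℕ-inject₁ a) (toℕ-inject₁ b)
      (trans (lookup-extend-inject₁ d c o a) (trans (extendOld-kept d c a c≢a) (cong injectOut e)))

  Semi-extend⁻ : ∀ {x} → Semi (extend d c o) x → (x ≡ n × o ≡ true) ⊎ (Semi d x × c ≢ just x)
  Semi-extend⁻ (semiAt i refl e) with view i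
  ... | ‵fromℕ = inj₁ (toℕ-fromℕ n , opening-semi⁻ o (trans (sym (lookup-extend-last d c o)) e))
  ... | ‵inject₁ a rewrite toℕ-inject₁ a =
    let semi-a , c≢a = extendOld-semi⁻ a (trans (sym (lookup-extend-inject₁ d c o a)) e)
    in inj₂ (IsSemi⇒Semi semi-a , c≢a)

  Semi-extend⁺ : ∀ {x} → Semi d x → c ≢ just x → Semi (extend d c o) x
  Semi-extend⁺ (semiAt a refl e) c≢a =
    semiAt (inject₁ a) (toℕ-inject₁ a)
      (trans (lookup-extend-inject₁ d c o a) (trans (extendOld-kept d c a c≢a) (cong injectOut e)))

Semi-extend-last : ∀ {n} (d : Diagram n) c → Semi (extend d c true) n
Semi-extend-last {n} d c = semiAt (fromℕ n) (toℕ-fromℕ n) (lookup-extend-last d c true)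

Arc-extend-last : ∀ {n} (d : Diagram n) o {s} → Semi d s → Arc (extend d (just s) o) s n
Arc-extend-last {n} d o (semiAt a refl _) =
  arcAt (inject₁ a) (fromℕ n) (toℕ-inject₁ a) (toℕ-fromℕ n)
    (trans (lookup-extend-inject₁ d (just (toℕ a)) o a) (extendOld-closed d a))

module _ {n : ℕ} (d : Diagram (suc n)) where
  Arc-restrict : ∀ {x y} → Arc (restrict d) x y → Arc d x y
  Arc-restrict (arcAt a b refl refl e) =
    arcAt (inject₁ a) (inject₁ b) (toℕ-inject₁ a) (toℕ-inject₁ b)
      (cutOut-arc⁻ (lookup d (inject₁ a)) (trans (sym (lookup-restrict d a)) e))

  Semi-restrict : ∀ {x} → Semi (restrict d) x → Semi d x ⊎ Arc d x n
  Semi-restrict (semiAt a refl e) with cutOut-semi⁻ (lookup d (inject₁ a)) (trans (sym (lookup-restrict d a)) e)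
  ... | inj₁ e′ = inj₁ (semiAt (inject₁ a) (toℕ-inject₁ a) e′)
  ... | inj₂ e′ = inj₂ (arcAt (inject₁ a) (fromℕ n) (toℕ-inject₁ a) (toℕ-fromℕ n) e′)

  -- A semi-arc of the restriction that was an arc into the last vertex would give a
  -- 3-nesting of d wherever it gave a future 3-nesting of the restriction.
  Valid-restrict : Valid d → Valid (restrict d)
  Valid-restrict ((arcs-forward , ends-unique) , no-nesting , no-future) =
    ((λ x y A → arcs-forward x y (Arc-restrict A)) ,
     (λ x x′ y A A′ → ends-unique x x′ y (Arc-restrict A) (Arc-restrict A′))) ,
    (λ { (nesting₃ p₁ p₂ p₃ p₄ p₅ A₁ A₂ A₃) →
         no-nesting (nesting₃ p₁ p₂ p₃ p₄ p₅ (Arc-restrict A₁) (Arc-restrict A₂) (Arc-restrict A₃)) }) ,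
    no-future′
    where
    no-future′ : ¬ FutureNesting₃ (restrict d)
    no-future′ (futureNesting₃ p₁ p₂ p₃ p₄ S₁ A₂ A₃) with Semi-restrict S₁
    ... | inj₁ S = no-future (futureNesting₃ p₁ p₂ p₃ p₄ S (Arc-restrict A₂) (Arc-restrict A₃))
    ... | inj₂ A₁ = no-nesting (nesting₃ p₁ p₂ p₃ p₄ (Arc-end<n A₂) A₁ (Arc-restrict A₂) (Arc-restrict A₃))

ClosesSemi : ∀ {n} → Diagram n → Maybe ℕ → Set
ClosesSemi d c = ∀ {s} → c ≡ just s → Semi d s

cutOut-extendOld : ∀ {n} (d : Diagram n) c → ClosesSemi d c → ∀ a → cutOut (extendOld d c a) ≡ lookup d a
cutOut-extendOld {n} d c closes-semi a with closes? c a
... | yes refl with closes-semi refl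
...   | semiAt a′ a′≡a e rewrite extendOld-closed d a | toℕ-injective a′≡a =
  trans (cong cutArc (view-fromℕ n)) (sym e)
cutOut-extendOld d c closes-semi a | no c≢a =
  trans (cong cutOut (extendOld-kept d c a c≢a)) (cutOut-injectOut (lookup d a))

restrict-extend : ∀ {n} (d : Diagram n) c o → ClosesSemi d c → restrict (extend d c o) ≡ d
restrict-extend d c o closes-semi = vec-ext λ a → begin
  lookup (restrict (extend d c o)) a          ≡⟨ lookup-restrict (extend d c o) a ⟩
  cutOut (lookup (extend d c o) (inject₁ a))  ≡⟨ cong cutOut (lookup-extend-inject₁ d c o a) ⟩
  cutOut (extendOld d c a)                    ≡⟨ cutOut-extendOld d c closes-semi a ⟩
  lookup d a                                  ∎
  where open ≡-Reasoning

extendOld-restrict : ∀ {n} (d : Diagram (suc n)) c a →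
  (c ≡ just (toℕ a)) ⇔ (lookup d (inject₁ a) ≡ arc (fromℕ n)) →
  extendOld (restrict d) c a ≡ lookup d (inject₁ a)
extendOld-restrict d c a closes⇔last with closes? c a
... | yes refl = trans (extendOld-closed (restrict d) a) (sym (Equivalence.to closes⇔last refl))
... | no  c≢a = begin
  extendOld (restrict d) c a               ≡⟨ extendOld-kept (restrict d) c a c≢a ⟩
  injectOut (lookup (restrict d) a)        ≡⟨ cong injectOut (lookup-restrict d a) ⟩
  injectOut (cutOut (lookup d (inject₁ a))) ≡⟨ injectOut-cutOut _ (c≢a ∘ Equivalence.from closes⇔last) ⟩
  lookup d (inject₁ a)                     ∎
  where open ≡-Reasoning

extend-restrict : ∀ {n} (d : Diagram (suc n)) c o →
  lookup d (fromℕ n) ≡ opening o →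
  (∀ a → (c ≡ just (toℕ a)) ⇔ (lookup d (inject₁ a) ≡ arc (fromℕ n))) →
  extend (restrict d) c o ≡ d
extend-restrict {n} d c o last≡o closes⇔last = vec-ext pointwise
  where
  pointwise : ∀ i → lookup (extend (restrict d) c o) i ≡ lookup d i
  pointwise i with view i
  ... | ‵fromℕ     = trans (lookup-extend-last (restrict d) c o) (sym last≡o)
  ... | ‵inject₁ a = trans (lookup-extend-inject₁ (restrict d) c o a) (extendOld-restrict d c a (closes⇔last a))

record Decomposition {n} (d : Diagram (suc n)) : Set where
  field
    closing        : Maybe ℕ
    opens          : Bool
    rebuilds       : extend (restrict d) closing opens ≡ d
    closesIntoLast : ∀ {s} → closing ≡ just s → Arc d s n × Semi (restrict d) s

decompose : ∀ {n} (d : Diagram (suc n)) → WellFormedℕ d → Decomposition d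
decompose {n} d (arcs-forward , ends-unique) = record
  { closing        = proj₁ closingVertex
  ; opens          = proj₁ lastOpening
  ; rebuilds       = extend-restrict d _ _ (proj₂ lastOpening) (proj₁ (proj₂ closingVertex))
  ; closesIntoLast = proj₂ (proj₂ closingVertex)
  }
  where
  lastOpening : ∃[ o ] lookup d (fromℕ n) ≡ opening o
  lastOpening with lookup d (fromℕ n) in e
  ... | none  = false , refl
  ... | semi  = true , refl
  ... | arc b = ⊥-elim (NP.<⇒≱ (subst (_< toℕ b) (toℕ-fromℕ n) (arcs-forward _ _ (IsArc⇒Arc e)))
                                (ℕ.s≤s⁻¹ (toℕ<n b)))
  ArcIntoLast : Fin n → Set
  ArcIntoLast a = lookup d (inject₁ a) ≡ arc (fromℕ n)
  arcIntoLast : ∀ {a} → ArcIntoLast a → Arc d (toℕ a) n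
  arcIntoLast {a} e = arcAt (inject₁ a) (fromℕ n) (toℕ-inject₁ a) (toℕ-fromℕ n) e
  closingVertex : ∃[ c ] (∀ a → (c ≡ just (toℕ a)) ⇔ ArcIntoLast a) ×
                         (∀ {s} → c ≡ just s → Arc d s n × Semi (restrict d) s)
  closingVertex with FP.any? (λ a → lookup d (inject₁ a) ≟Out arc (fromℕ n))
  ... | yes (a , e) =
    just (toℕ a) ,
    (λ a′ → mk⇔ (λ a≡a′ → subst ArcIntoLast (toℕ-injective (just-injective a≡a′)) e)
                (λ e′ → cong just (ends-unique _ _ _ (arcIntoLast e) (arcIntoLast e′)))) ,
    λ { refl → arcIntoLast e ,
               IsSemi⇒Semi (trans (lookup-restrict d a) (trans (cong cutOut e) (cong cutArc (view-fromℕ n)))) }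
  ... | no ¬into-last = nothing , (λ a → mk⇔ (λ ()) (λ e → ⊥-elim (¬into-last (a , e)))) , λ ()

extend-closing-unique : ∀ {n} (d : Diagram n) {s o c′ o′} → Semi d s →
  extend d (just s) o ≡ extend d c′ o′ → c′ ≡ just s
extend-closing-unique {n} d {s} {o} {c′} {o′} S eq
  with ExtendView.Arc-extend⁻ d c′ o′ (subst (λ d′ → Arc d′ s n) eq (Arc-extend-last d o S))
... | inj₁ (c′≡s , _) = c′≡s
... | inj₂ A = ⊥-elim (NP.<-irrefl refl (Arc-end<n A))

extend-injective : ∀ {n} (d : Diagram n) {c c′ o o′} → ClosesSemi d c → ClosesSemi d c′ →
  extend d c o ≡ extend d c′ o′ → c ≡ c′ × o ≡ o′
extend-injective {n} d {c} {c′} {o} {o′} closes closes′ eq = closing≡ c c′ closes closes′ eq , opening≡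
  where
  opening≡ : o ≡ o′
  opening≡ = opening-injective o o′ (begin
    opening o                           ≡⟨ lookup-extend-last d c o ⟨
    lookup (extend d c o) (fromℕ n)     ≡⟨ cong (λ d′ → lookup d′ (fromℕ n)) eq ⟩
    lookup (extend d c′ o′) (fromℕ n)   ≡⟨ lookup-extend-last d c′ o′ ⟩
    opening o′                          ∎)
    where open ≡-Reasoning
  closing≡ : ∀ c c′ → ClosesSemi d c → ClosesSemi d c′ → extend d c o ≡ extend d c′ o′ → c ≡ c′
  closing≡ (just s) c′       closes _       eq = sym (extend-closing-unique d (closes refl) eq)
  closing≡ nothing  (just s) _      closes′ eq = extend-closing-unique d (closes′ refl) (sym eq)
  closing≡ nothing  nothing  _      _       _  = refl

-- Closing s creates an arc ending at the new vertex, nested inside every arc starting after s;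
-- this is harmless unless a semi-arc to the left of s then forms a future 3-nesting.
SafeClosing : ∀ {n} → Diagram n → Maybe ℕ → Set
SafeClosing d c = ∀ {s} → c ≡ just s → Semi d s × (¬ ArcStartsAfter d s ⊎ (∀ x → Semi d x → s ≤ x))

SafeClosing-noFuture : ∀ {n} {d : Diagram n} {c s x} → SafeClosing d c → c ≡ just s →
  Semi d x → x < s → ¬ ArcStartsAfter d s
SafeClosing-noFuture safe c≡s S x<s with proj₂ (safe c≡s)
... | inj₁ free     = free
... | inj₂ leftmost = λ _ → NP.<⇒≱ x<s (leftmost _ S)

Arc-end≯last : ∀ {n} {d : Diagram (suc n)} {x y} → Arc d x y → ¬ (n < y)
Arc-end≯last A n<y = NP.<⇒≱ n<y (ℕ.s≤s⁻¹ (Arc-end<n A))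

Valid-extend : ∀ {n} (d : Diagram n) c o → Valid d → SafeClosing d c → Valid (extend d c o)
Valid-extend {n} d c o ((arcs-forward , ends-unique) , no-nesting , no-future) safe =
  (arcs-forward′ , ends-unique′) , no-nesting′ , no-future′
  where
  open ExtendView d c o
  arcs-forward′ : ∀ x y → Arc (extend d c o) x y → x < y
  arcs-forward′ x y A with Arc-extend⁻ A
  ... | inj₁ (_ , refl , x<n) = x<n
  ... | inj₂ A′ = arcs-forward x y A′
  ends-unique′ : ∀ x x′ y → Arc (extend d c o) x y → Arc (extend d c o) x′ y → x ≡ x′
  ends-unique′ x x′ y A A′ with Arc-extend⁻ A | Arc-extend⁻ A′
  ... | inj₁ (e , _ , _)    | inj₁ (e′ , _ , _)   = just-injective (trans (sym e) e′)
  ... | inj₁ (_ , refl , _) | inj₂ B′             = ⊥-elim (NP.<-irrefl refl (Arc-end<n B′))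
  ... | inj₂ B              | inj₁ (_ , refl , _) = ⊥-elim (NP.<-irrefl refl (Arc-end<n B))
  ... | inj₂ B              | inj₂ B′             = ends-unique x x′ y B B′
  -- A 3-nesting through the new arc is a future 3-nesting of d, through its closed semi-arc.
  no-nesting′ : ¬ Nesting₃ (extend d c o)
  no-nesting′ (nesting₃ p₁ p₂ p₃ p₄ p₅ A₁ A₂ A₃) with Arc-extend⁻ A₂ | Arc-extend⁻ A₃
  ... | inj₁ (_ , refl , _) | _                   = Arc-end≯last A₁ p₅
  ... | inj₂ _              | inj₁ (_ , refl , _) = Arc-end≯last A₁ (NP.<-trans p₄ p₅)
  ... | inj₂ B₂             | inj₂ B₃ with Arc-extend⁻ A₁
  ...   | inj₂ B₁          = no-nesting (nesting₃ p₁ p₂ p₃ p₄ p₅ B₁ B₂ B₃)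
  ...   | inj₁ (e , _ , _) = no-future (futureNesting₃ p₁ p₂ p₃ p₄ (proj₁ (safe e)) B₂ B₃)
  no-future′ : ¬ FutureNesting₃ (extend d c o)
  no-future′ (futureNesting₃ p₁ p₂ p₃ p₄ S₁ A₂ A₃) with Arc-extend⁻ A₃
  ... | inj₁ (_ , refl , _) = Arc-end≯last A₂ p₄
  ... | inj₂ B₃ with Semi-extend⁻ S₁
  ...   | inj₁ (refl , _) = Arc-end≯last A₂ (NP.<-trans p₁ (NP.<-trans p₂ (NP.<-trans p₃ p₄)))
  ...   | inj₂ (T₁ , _) with Arc-extend⁻ A₂
  ...     | inj₂ B₂          = no-future (futureNesting₃ p₁ p₂ p₃ p₄ T₁ B₂ B₃)
  ...     | inj₁ (e , _ , _) = SafeClosing-noFuture safe e T₁ p₁ (_ , _ , p₂ , B₃)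

module _ {R : ℕ → ℕ → Set} where
  AllPairs-before : ∀ (xs : List ℕ) {y ys z} → AllPairs R (xs ++ y ∷ ys) → z ∈ xs → R z y
  AllPairs-before (_ ∷ xs) (rx ∷ _) (here refl) = All.lookup rx (∈-++⁺ʳ xs (here refl))
  AllPairs-before (_ ∷ xs) (_ ∷ r)  (there p)   = AllPairs-before xs r p

  AllPairs-after : ∀ (xs : List ℕ) {y ys z} → AllPairs R (xs ++ y ∷ ys) → z ∈ ys → R y z
  AllPairs-after []       (ry ∷ _) p = All.lookup ry p
  AllPairs-after (_ ∷ xs) (_ ∷ r)  p = AllPairs-after xs r p

  AllPairs-dropMid : ∀ (xs : List ℕ) {y ys} → AllPairs R (xs ++ y ∷ ys) → AllPairs R (xs ++ ys)
  AllPairs-dropMid []       (_ ∷ r)  = r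
  AllPairs-dropMid (_ ∷ xs) (rx ∷ r) = All-dropMid xs rx ∷ AllPairs-dropMid xs r
    where
    All-dropMid : ∀ {P : ℕ → Set} (xs : List ℕ) {y ys} → All P (xs ++ y ∷ ys) → All P (xs ++ ys)
    All-dropMid []       (_ ∷ ps)  = ps
    All-dropMid (_ ∷ xs) (px ∷ ps) = px ∷ All-dropMid xs ps

  AllPairs-++⁻ʳ : ∀ (xs : List ℕ) {ys} → AllPairs R (xs ++ ys) → AllPairs R ys
  AllPairs-++⁻ʳ []       r       = r
  AllPairs-++⁻ʳ (_ ∷ xs) (_ ∷ r) = AllPairs-++⁻ʳ xs r

∈-insertMid : ∀ (xs : List ℕ) {y ys z} → z ∈ xs ++ ys → z ∈ xs ++ y ∷ ys
∈-insertMid xs p with ∈-++⁻ xs p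
... | inj₁ q = ∈-++⁺ˡ q
... | inj₂ q = ∈-++⁺ʳ xs (there q)

∈-deleteMid : ∀ (xs : List ℕ) {y ys z} → z ∈ xs ++ y ∷ ys → z ≢ y → z ∈ xs ++ ys
∈-deleteMid xs p z≢y with ∈-++⁻ xs p
... | inj₁ q         = ∈-++⁺ˡ q
... | inj₂ (here e)  = ⊥-elim (z≢y e)
... | inj₂ (there q) = ∈-++⁺ʳ xs q

snocIf : Bool → ℕ → List ℕ → List ℕ
snocIf false n ys = ys
snocIf true  n ys = ys ++ n ∷ []

∈-snocIf⁻ : ∀ (xs ys : List ℕ) o n {x} → x ∈ xs ++ snocIf o n ys → x ∈ xs ++ ys ⊎ (o ≡ true × x ≡ n)
∈-snocIf⁻ xs ys false n p = inj₁ p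
∈-snocIf⁻ xs ys true  n p rewrite sym (LP.++-assoc xs ys (n ∷ [])) with ∈-++⁻ (xs ++ ys) p
... | inj₁ q        = inj₁ q
... | inj₂ (here e) = inj₂ (refl , e)

∈-snocIf⁺ : ∀ (xs ys : List ℕ) o n {x} → x ∈ xs ++ ys → x ∈ xs ++ snocIf o n ys
∈-snocIf⁺ xs ys false n p = p
∈-snocIf⁺ xs ys true  n p rewrite sym (LP.++-assoc xs ys (n ∷ [])) = ∈-++⁺ˡ p

∈-snocIf-last : ∀ (xs ys : List ℕ) n → n ∈ xs ++ snocIf true n ys
∈-snocIf-last xs ys n rewrite sym (LP.++-assoc xs ys (n ∷ [])) = ∈-++⁺ʳ (xs ++ ys) (here refl)

AllPairs-snocIf : ∀ (xs ys : List ℕ) o n → AllPairs _<_ (xs ++ ys) → (∀ {x} → x ∈ xs ++ ys → x < n) →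
  AllPairs _<_ (xs ++ snocIf o n ys)
AllPairs-snocIf xs ys false n sorted _ = sorted
AllPairs-snocIf xs ys true  n sorted below rewrite sym (LP.++-assoc xs ys (n ∷ [])) =
  APP.++⁺ sorted ([] ∷ []) (All.tabulate (λ p → below p ∷ []))

record Tracks {n} (d : Diagram n) (B F : List ℕ) : Set where
  field
    valid       : Valid d
    increasing  : AllPairs _<_ (B ++ F)
    listed⇒semi : ∀ {x} → x ∈ B ++ F → Semi d x
    semi⇒listed : ∀ {x} → Semi d x → x ∈ B ++ F
    blocked     : ∀ {x} → x ∈ B → ArcStartsAfter d x
    free        : ∀ {x} → x ∈ F → ¬ ArcStartsAfter d x

-- B and F list the semi-arcs of d left open by the closing c, classified as they will be
-- once the new vertex, closing c, has been added.
record Reclassifies {n} (d : Diagram n) (c : Maybe ℕ) (B F : List ℕ) : Set where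
  field
    increasing  : AllPairs _<_ (B ++ F)
    listed⇒kept : ∀ {x} → x ∈ B ++ F → Semi d x × c ≢ just x
    kept⇒listed : ∀ {x} → Semi d x → c ≢ just x → x ∈ B ++ F
    blocked     : ∀ {x} → x ∈ B → ArcStartsAfter d x ⊎ ∃[ s ] c ≡ just s × x < s
    free        : ∀ {x} → x ∈ F → ¬ ArcStartsAfter d x × (∀ {s} → c ≡ just s → s ≤ x)

Tracks-extend : ∀ {n} (d : Diagram n) c o {B F} → Valid d → SafeClosing d c → Reclassifies d c B F →
  Tracks (extend d c o) B (snocIf o n F)
Tracks-extend {n} d c o {B} {F} valid safe re = record
  { valid       = Valid-extend d c o valid safe
  ; increasing  = AllPairs-snocIf B F o n R.increasing (Semi<n ∘ proj₁ ∘ R.listed⇒kept)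
  ; listed⇒semi = listed⇒semi
  ; semi⇒listed = semi⇒listed
  ; blocked     = blocked
  ; free        = free
  }
  where
  module R = Reclassifies re
  open ExtendView d c o
  listed⇒semi : ∀ {x} → x ∈ B ++ snocIf o n F → Semi (extend d c o) x
  listed⇒semi p with ∈-snocIf⁻ B F o n p
  ... | inj₁ q = uncurry Semi-extend⁺ (R.listed⇒kept q)
  ... | inj₂ (refl , refl) = Semi-extend-last d c
  semi⇒listed : ∀ {x} → Semi (extend d c o) x → x ∈ B ++ snocIf o n F
  semi⇒listed S with Semi-extend⁻ S
  ... | inj₁ (refl , refl) = ∈-snocIf-last B F n
  ... | inj₂ (S′ , c≢x)    = ∈-snocIf⁺ B F o n (R.kept⇒listed S′ c≢x)
  blocked : ∀ {x} → x ∈ B → ArcStartsAfter (extend d c o) x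
  blocked p with R.blocked p
  ... | inj₁ (y , z , x<y , A) =
    y , z , x<y , Arc-extend⁺ A (λ c≡y → Semi-Arc-disjoint (proj₁ (safe c≡y)) A)
  ... | inj₂ (s , refl , x<s) = s , n , x<s , Arc-extend-last d o (proj₁ (safe refl))
  free : ∀ {x} → x ∈ snocIf o n F → ¬ ArcStartsAfter (extend d c o) x
  free p (y , z , x<y , A) with ∈-snocIf⁻ [] F o n p
  ... | inj₂ (_ , refl) = NP.<⇒≱ x<y (ℕ.s≤s⁻¹ (Arc-start<n A))
  ... | inj₁ q with Arc-extend⁻ A
  ...   | inj₁ (c≡y , _ , _) = NP.<⇒≱ x<y (proj₂ (R.free q) c≡y)
  ...   | inj₂ A′            = proj₁ (R.free q) (y , z , x<y , A′)

Choice : Set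
Choice = Maybe ℕ × Bool

State : Set
State = List ℕ × List ℕ

closeFree : Bool → ℕ → List ℕ → List ℕ → List (Choice × State)
closeFree o n B []      = []
closeFree o n B (x ∷ S) = ((just x , o) , (B , snocIf o n S)) ∷ closeFree o n (B ++ x ∷ []) S

closeFirstBlocked : ℕ → List ℕ → List ℕ → List (Choice × State)
closeFirstBlocked n []       F = []
closeFirstBlocked n (h ∷ B′) F =
  ((just h , true) , (B′ , snocIf true n F)) ∷ ((just h , false) , (B′ , F)) ∷ []

-- The listing order matches the order of the entries of the succession rule.
choices : ℕ → List ℕ → List ℕ → List (Choice × State)
choices n B F =
  ((nothing , false) , (B , F)) ∷ ((nothing , true) , (B , snocIf true n F)) ∷
  (closeFree true n B F ++ closeFree false n B F ++ closeFirstBlocked n B F)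

data Move (n : ℕ) (B F : List ℕ) : Maybe ℕ → Bool → List ℕ → List ℕ → Set where
  keepAll       : ∀ o → Move n B F nothing o B (snocIf o n F)
  closeFreeAt   : ∀ o P x S → F ≡ P ++ x ∷ S → Move n B F (just x) o (B ++ P) (snocIf o n S)
  closeFirstOf  : ∀ o h B′ → B ≡ h ∷ B′ → Move n B F (just h) o B′ (snocIf o n F)

∈-closeFree⁻ : ∀ o n B F {c o′ B′ F′} → ((c , o′) , (B′ , F′)) ∈ closeFree o n B F →
  ∃[ P ] ∃[ x ] ∃[ S ] F ≡ P ++ x ∷ S × c ≡ just x × o′ ≡ o × B′ ≡ B ++ P × F′ ≡ snocIf o n S
∈-closeFree⁻ o n B (x ∷ S) (here refl) = [] , x , S , refl , refl , refl , sym (LP.++-identityʳ B) , refl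
∈-closeFree⁻ o n B (x ∷ S) (there p) with ∈-closeFree⁻ o n (B ++ x ∷ []) S p
... | P , y , S′ , refl , refl , refl , refl , refl =
  x ∷ P , y , S′ , refl , refl , refl , LP.++-assoc B (x ∷ []) P , refl

∈-closeFree⁺ : ∀ o n B P x S → ((just x , o) , (B ++ P , snocIf o n S)) ∈ closeFree o n B (P ++ x ∷ S)
∈-closeFree⁺ o n B []      x S = here (cong (λ B′ → (just x , o) , (B′ , snocIf o n S)) (LP.++-identityʳ B))
∈-closeFree⁺ o n B (y ∷ P) x S =
  there (subst (λ B′ → ((just x , o) , (B′ , snocIf o n S)) ∈ closeFree o n (B ++ y ∷ []) (P ++ x ∷ S))
               (LP.++-assoc B (y ∷ []) P) (∈-closeFree⁺ o n (B ++ y ∷ []) P x S))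

∈-choices⁻ : ∀ n B F {c o B′ F′} → ((c , o) , (B′ , F′)) ∈ choices n B F → Move n B F c o B′ F′
∈-choices⁻ n B F (here refl)         = keepAll false
∈-choices⁻ n B F (there (here refl)) = keepAll true
∈-choices⁻ n B F (there (there p)) with ∈-++⁻ (closeFree true n B F) p
... | inj₁ q with ∈-closeFree⁻ true n B F q
...   | P , x , S , F≡ , refl , refl , refl , refl = closeFreeAt true P x S F≡
∈-choices⁻ n B F (there (there p)) | inj₂ q with ∈-++⁻ (closeFree false n B F) q
... | inj₁ r with ∈-closeFree⁻ false n B F r
...   | P , x , S , F≡ , refl , refl , refl , refl = closeFreeAt false P x S F≡
∈-choices⁻ n (h ∷ B′) F (there (there p)) | inj₂ q | inj₂ (here refl)         = closeFirstOf true h B′ refl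
∈-choices⁻ n (h ∷ B′) F (there (there p)) | inj₂ q | inj₂ (there (here refl)) = closeFirstOf false h B′ refl

∈-choices⁺ : ∀ {n B F c o B′ F′} → Move n B F c o B′ F′ → ((c , o) , (B′ , F′)) ∈ choices n B F
∈-choices⁺ (keepAll false) = here refl
∈-choices⁺ (keepAll true)  = there (here refl)
∈-choices⁺ {n} {B} (closeFreeAt true P x S refl) =
  there (there (∈-++⁺ˡ (∈-closeFree⁺ true n B P x S)))
∈-choices⁺ {n} {B} (closeFreeAt false P x S refl) =
  there (there (∈-++⁺ʳ (closeFree true n B (P ++ x ∷ S)) (∈-++⁺ˡ (∈-closeFree⁺ false n B P x S))))
∈-choices⁺ {n} {B} {F} (closeFirstOf true h B′ refl) =
  there (there (∈-++⁺ʳ (closeFree true n B F) (∈-++⁺ʳ (closeFree false n B F) (here refl))))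
∈-choices⁺ {n} {B} {F} (closeFirstOf false h B′ refl) =
  there (there (∈-++⁺ʳ (closeFree true n B F) (∈-++⁺ʳ (closeFree false n B F) (there (here refl)))))

Tracks-keep : ∀ {n} {d : Diagram n} {B F} o → Tracks d B F → Tracks (extend d nothing o) B (snocIf o n F)
Tracks-keep {d = d} o t = Tracks-extend d nothing o valid (λ ()) (record
  { increasing  = increasing
  ; listed⇒kept = λ p → listed⇒semi p , λ ()
  ; kept⇒listed = λ S _ → semi⇒listed S
  ; blocked     = inj₁ ∘ blocked
  ; free        = λ p → free p , λ ()
  })
  where open Tracks t

-- Closing the free semi-arc x blocks the free semi-arcs P to its left: the new arc (x, n)
-- starts after them.
Tracks-closeFree : ∀ {n} {d : Diagram n} {B} P x S o → Tracks d B (P ++ x ∷ S) →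
  Tracks (extend d (just x) o) (B ++ P) (snocIf o n S)
Tracks-closeFree {n} {d} {B} P x S o t = Tracks-extend d (just x) o valid safe (record
  { increasing  = AllPairs-dropMid (B ++ P) sorted
  ; listed⇒kept = λ p → listed⇒semi (subst (_ ∈_) (sym regroup) (∈-insertMid (B ++ P) p)) , x≢listed p
  ; kept⇒listed = λ S′ x≢y →
      ∈-deleteMid (B ++ P) (subst (_ ∈_) regroup (semi⇒listed S′)) (x≢y ∘ cong just ∘ sym)
  ; blocked     = λ p → inj₂ (x , refl , AllPairs-before (B ++ P) sorted p)
  ; free        = λ p → free (∈-++⁺ʳ P (there p)) , λ { refl → NP.<⇒≤ (AllPairs-after (B ++ P) sorted p) }
  })
  where
  open Tracks t
  regroup : B ++ P ++ x ∷ S ≡ (B ++ P) ++ x ∷ S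
  regroup = sym (LP.++-assoc B P (x ∷ S))
  sorted : AllPairs _<_ ((B ++ P) ++ x ∷ S)
  sorted = subst (AllPairs _<_) regroup increasing
  x∈F : x ∈ P ++ x ∷ S
  x∈F = ∈-++⁺ʳ P (here refl)
  safe : SafeClosing d (just x)
  safe refl = listed⇒semi (∈-++⁺ʳ B x∈F) , inj₁ (free x∈F)
  x≢listed : ∀ {y} → y ∈ (B ++ P) ++ S → just x ≢ just y
  x≢listed {y} p x≡y with just-injective x≡y | ∈-++⁻ (B ++ P) p
  ... | refl | inj₁ q = NP.<-irrefl refl (AllPairs-before (B ++ P) sorted q)
  ... | refl | inj₂ q = NP.<-irrefl refl (AllPairs-after (B ++ P) sorted q)

Tracks-closeFirst : ∀ {n} {d : Diagram n} h B F o → Tracks d (h ∷ B) F →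
  Tracks (extend d (just h) o) B (snocIf o n F)
Tracks-closeFirst {n} {d} h B F o t = Tracks-extend d (just h) o valid safe (record
  { increasing  = AP.tail increasing
  ; listed⇒kept = λ p → listed⇒semi (there p) , λ h≡y → NP.<-irrefl (just-injective h≡y) (head< p)
  ; kept⇒listed = kept⇒listed
  ; blocked     = λ p → inj₁ (blocked (there p))
  ; free        = λ p → free p , λ { refl → NP.<⇒≤ (head< (∈-++⁺ʳ B p)) }
  })
  where
  open Tracks t
  head< : ∀ {y} → y ∈ B ++ F → h < y
  head< = All.lookup (AP.head increasing)
  leftmost : ∀ y → Semi d y → h ≤ y
  leftmost y S with semi⇒listed S
  ... | here refl = NP.≤-refl
  ... | there p   = NP.<⇒≤ (head< p)
  safe : SafeClosing d (just h)
  safe refl = listed⇒semi (here refl) , inj₂ leftmost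
  kept⇒listed : ∀ {y} → Semi d y → just h ≢ just y → y ∈ B ++ F
  kept⇒listed S h≢y with semi⇒listed S
  ... | here refl = ⊥-elim (h≢y refl)
  ... | there p   = p

Tracks-move : ∀ {n} {d : Diagram n} {B F c o B′ F′} → Tracks d B F → Move n B F c o B′ F′ →
  Tracks (extend d c o) B′ F′
Tracks-move t (keepAll o)                = Tracks-keep o t
Tracks-move t (closeFreeAt o P x S refl) = Tracks-closeFree P x S o t
Tracks-move t (closeFirstOf o h B′ refl) = Tracks-closeFirst h B′ _ o t

Move-closesSemi : ∀ {n} {d : Diagram n} {B F c o B′ F′} → Tracks d B F → Move n B F c o B′ F′ → ClosesSemi d c
Move-closesSemi t (keepAll o) ()
Move-closesSemi {B = B} t (closeFreeAt o P x S refl) refl = Tracks.listed⇒semi t (∈-++⁺ʳ B (∈-++⁺ʳ P (here refl)))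
Move-closesSemi t (closeFirstOf o h B′ refl)         refl = Tracks.listed⇒semi t (here refl)

-- A blocked semi-arc s other than the leftmost one h cannot be closed: h would then be the
-- outer arc of a future 3-nesting, or, if h is closed at n as well, share the end-point n with s.
move-exists : ∀ {n} (d : Diagram (suc n)) → Valid d → ∀ {B F} → Tracks (restrict d) B F → ∀ c o →
  (∀ {s} → c ≡ just s → Arc d s n × Semi (restrict d) s) → ∃[ B′ ] ∃[ F′ ] Move n B F c o B′ F′
move-exists d valid t nothing o _ = _ , _ , keepAll o
move-exists {n} d ((arcs-forward , ends-unique) , _ , no-future) {B} {F} t (just s) o into-last
  with into-last refl
... | s→n , semi-s with ∈-++⁻ B (Tracks.semi⇒listed t semi-s)
...   | inj₂ s∈F = let P , S , F≡ = ∈-∃++ s∈F in _ , _ , closeFreeAt o P s S F≡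
...   | inj₁ (here refl) = _ , _ , closeFirstOf o s _ refl
...   | inj₁ (there {x = h} s∈B′) = ⊥-elim first-blocked
  where
  open Tracks t
  h<s : h < s
  h<s = All.lookup (AP.head increasing) (∈-++⁺ˡ s∈B′)
  first-blocked : ⊥
  first-blocked with blocked (there s∈B′)
  ... | y , z , s<y , A with Semi-restrict d (listed⇒semi (here refl))
  ...   | inj₁ semi-h = no-future (futureNesting₃ h<s s<y (arcs-forward _ _ (Arc-restrict d A)) (Arc-end<n A)
                                                  semi-h s→n (Arc-restrict d A))
  ...   | inj₂ h→n   = NP.<-irrefl (ends-unique _ _ _ h→n s→n) h<s

label : State → Label
label (B , F) = (length B + length F , length B)

labels : List (Choice × State) → List Label
labels = map (label ∘ proj₂)

length-snoc : ∀ (xs : List ℕ) y → length (xs ++ y ∷ []) ≡ suc (length xs)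
length-snoc xs y = trans (LP.length-++ xs) (NP.+-comm (length xs) 1)

applyUpTo-cong : ∀ {A : Set} {f g : ℕ → A} → (∀ k → f k ≡ g k) → ∀ m → applyUpTo f m ≡ applyUpTo g m
applyUpTo-cong f≗g zero    = refl
applyUpTo-cong f≗g (suc m) = cong₂ _∷_ (f≗g 0) (applyUpTo-cong (f≗g ∘ suc) m)

size-snocIf : ∀ o n (B S : List ℕ) {i} → length B + suc (length S) ≡ suc i →
  length B + length (snocIf o n S) ≡ (if o then suc i else i)
size-snocIf true  n B S eq = trans (cong (length B +_) (length-snoc S n)) eq
size-snocIf false n B S eq = NP.suc-injective (trans (sym (NP.+-suc (length B) (length S))) eq)

labels-closeFree : ∀ o n B F {i} → length B + length F ≡ suc i →
  labels (closeFree o n B F) ≡ applyUpTo (λ k → ((if o then suc i else i) , length B + k)) (length F)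
labels-closeFree o n B []      eq = refl
labels-closeFree o n B (x ∷ S) {i} eq =
  cong₂ _∷_ (cong₂ _,_ (size-snocIf o n B S eq) (sym (NP.+-identityʳ (length B))))
            (trans (labels-closeFree o n (B ++ x ∷ []) S (trans (shift (length S)) eq))
                   (applyUpTo-cong (cong ((if o then suc i else i) ,_) ∘ shift) (length S)))
  where
  shift : ∀ k → length (B ++ x ∷ []) + k ≡ length B + suc k
  shift k = trans (cong (_+ k) (length-snoc B x)) (sym (NP.+-suc (length B) k))

map-range : ∀ (B F : List ℕ) {i} (c : ℕ) → length B + length F ≡ i →
  map (λ m → (c , m)) (range (length B) i) ≡ applyUpTo (λ k → (c , length B + k)) (length F)
map-range B F c refl rewrite NP.m+n∸m≡n (length B) (length F) =
  trans (sym (LP.map-∘ (L.upTo (length F)))) (LP.map-upTo _ (length F))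

firstBlockedLabels : List ℕ → ℕ → List Label
firstBlockedLabels []       i = []
firstBlockedLabels (_ ∷ B′) i = (suc i , length B′) ∷ (i , length B′) ∷ []

labels-closeFirstBlocked : ∀ n B F {i} → length B + length F ≡ suc i →
  labels (closeFirstBlocked n B F) ≡ firstBlockedLabels B i
labels-closeFirstBlocked n []       F eq = refl
labels-closeFirstBlocked n (_ ∷ B′) F eq =
  cong₂ _∷_ (cong (_, length B′) (size-snocIf true n B′ F eq′))
            (cong₂ _∷_ (cong (_, length B′) (size-snocIf false n B′ F eq′)) refl)
  where
  eq′ : length B′ + suc (length F) ≡ _
  eq′ = trans (NP.+-suc (length B′) (length F)) eq

labels-choices-nonempty : ∀ n B F {i} → length B + length F ≡ suc i →
  labels (choices n B F) ≡
  (suc i , length B) ∷ (suc (suc i) , length B) ∷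
  (map (λ m → (suc i , m)) (range (length B) (suc i)) ++
   map (λ m → (i , m)) (range (length B) (suc i)) ++ firstBlockedLabels B i)
labels-choices-nonempty n B F {i} eq =
  cong₂ _∷_ (cong (_, length B) eq) (cong₂ _∷_ (cong (_, length B) opened) (begin
    labels (closeFree true n B F ++ closeFree false n B F ++ closeFirstBlocked n B F)
      ≡⟨ LP.map-++ (label ∘ proj₂) (closeFree true n B F) _ ⟩
    labels (closeFree true n B F) ++ labels (closeFree false n B F ++ closeFirstBlocked n B F)
      ≡⟨ cong (labels (closeFree true n B F) ++_) (LP.map-++ (label ∘ proj₂) (closeFree false n B F) _) ⟩
    labels (closeFree true n B F) ++ labels (closeFree false n B F) ++ labels (closeFirstBlocked n B F)
      ≡⟨ cong₂ _++_ (trans (labels-closeFree true n B F eq) (sym (map-range B F (suc i) eq)))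
                    (cong₂ _++_ (trans (labels-closeFree false n B F eq) (sym (map-range B F i eq)))
                                (labels-closeFirstBlocked n B F eq)) ⟩
    map (λ m → (suc i , m)) (range (length B) (suc i)) ++
    map (λ m → (i , m)) (range (length B) (suc i)) ++ firstBlockedLabels B i ∎))
  where
  open ≡-Reasoning
  opened : length B + length (snocIf true n F) ≡ suc (suc i)
  opened = trans (cong (length B +_) (length-snoc F n)) (trans (NP.+-suc (length B) (length F)) (cong suc eq))

labels-choices : ∀ n B F → labels (choices n B F) ≡ rule (label (B , F))
labels-choices n []      []      = refl
labels-choices n []      (x ∷ F) = labels-choices-nonempty n [] (x ∷ F) refl
labels-choices n (h ∷ B) F       = labels-choices-nonempty n (h ∷ B) F refl

closingKeys : Bool → List ℕ → List Choice
closingKeys o = map (λ x → (just x , o))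

keysFirstBlocked : List ℕ → List Choice
keysFirstBlocked []      = []
keysFirstBlocked (h ∷ _) = (just h , true) ∷ (just h , false) ∷ []

keys-closeFree : ∀ o n B F → map proj₁ (closeFree o n B F) ≡ closingKeys o F
keys-closeFree o n B []      = refl
keys-closeFree o n B (x ∷ F) = cong ((just x , o) ∷_) (keys-closeFree o n (B ++ x ∷ []) F)

keys-closeFirstBlocked : ∀ n B F → map proj₁ (closeFirstBlocked n B F) ≡ keysFirstBlocked B
keys-closeFirstBlocked n []      F = refl
keys-closeFirstBlocked n (_ ∷ B) F = refl

keys-choices : ∀ n B F → map proj₁ (choices n B F) ≡
  (nothing , false) ∷ (nothing , true) ∷ (closingKeys true F ++ closingKeys false F ++ keysFirstBlocked B)
keys-choices n B F = cong (λ ks → (nothing , false) ∷ (nothing , true) ∷ ks) (begin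
  map proj₁ (closeFree true n B F ++ closeFree false n B F ++ closeFirstBlocked n B F)
    ≡⟨ LP.map-++ proj₁ (closeFree true n B F) _ ⟩
  map proj₁ (closeFree true n B F) ++ map proj₁ (closeFree false n B F ++ closeFirstBlocked n B F)
    ≡⟨ cong (map proj₁ (closeFree true n B F) ++_) (LP.map-++ proj₁ (closeFree false n B F) _) ⟩
  map proj₁ (closeFree true n B F) ++ map proj₁ (closeFree false n B F) ++ map proj₁ (closeFirstBlocked n B F)
    ≡⟨ cong₂ _++_ (keys-closeFree true n B F)
                  (cong₂ _++_ (keys-closeFree false n B F) (keys-closeFirstBlocked n B F)) ⟩
  closingKeys true F ++ closingKeys false F ++ keysFirstBlocked B ∎)
  where open ≡-Reasoning

closingKeys-unique : ∀ o {F} → Unique F → Unique (closingKeys o F)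
closingKeys-unique o = UP.map⁺ λ { refl → refl }

∈-closingKeys⁻ : ∀ {o F c o′} → (c , o′) ∈ closingKeys o F → ∃[ x ] x ∈ F × c ≡ just x × o′ ≡ o
∈-closingKeys⁻ p with ∈-map⁻ _ p
... | x , x∈F , refl = x , x∈F , refl , refl

∈-keysFirstBlocked⁻ : ∀ {B c o} → (c , o) ∈ keysFirstBlocked B → ∃[ h ] ∃[ B′ ] B ≡ h ∷ B′ × c ≡ just h
∈-keysFirstBlocked⁻ {h ∷ B′} (here refl)         = h , B′ , refl , refl
∈-keysFirstBlocked⁻ {h ∷ B′} (there (here refl)) = h , B′ , refl , refl

closing-keys-close : ∀ {B F c o} → (c , o) ∈ closingKeys true F ++ closingKeys false F ++ keysFirstBlocked B →
  ∃[ s ] c ≡ just s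
closing-keys-close {B} {F} p with ∈-++⁻ (closingKeys true F) p
... | inj₁ q = let x , _ , c≡x , _ = ∈-closingKeys⁻ q in x , c≡x
... | inj₂ q with ∈-++⁻ (closingKeys false F) q
...   | inj₁ r = let x , _ , c≡x , _ = ∈-closingKeys⁻ r in x , c≡x
...   | inj₂ r = let h , _ , _ , c≡h = ∈-keysFirstBlocked⁻ r in h , c≡h

keysFirstBlocked-avoids : ∀ {B F x o} → AllPairs _<_ (B ++ F) → (just x , o) ∈ keysFirstBlocked B → x ∉ F
keysFirstBlocked-avoids increasing p x∈F with ∈-keysFirstBlocked⁻ p
... | h , B′ , refl , refl = NP.<-irrefl refl (All.lookup (AP.head increasing) (∈-++⁺ʳ B′ x∈F))

keys-choices-unique : ∀ n B F → AllPairs _<_ (B ++ F) → Unique (map proj₁ (choices n B F))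
keys-choices-unique n B F increasing rewrite keys-choices n B F =
  All.tabulate (λ { (here refl) () ; (there p) refl → nothing≢just (closing-keys-close {B} {F} p) }) ∷
  All.tabulate (λ { p refl → nothing≢just (closing-keys-close {B} {F} p) }) ∷
  UP.++⁺ (closingKeys-unique true uniqueF)
         (UP.++⁺ (closingKeys-unique false uniqueF) (keysFirstBlocked-unique B) false-vs-first)
         true-vs-rest
  where
  nothing≢just : ¬ (∃[ s ] nothing ≡ just s)
  nothing≢just (_ , ())
  uniqueF : Unique F
  uniqueF = AP.map (λ x<y x≡y → NP.<-irrefl x≡y x<y) (AllPairs-++⁻ʳ B increasing)
  keysFirstBlocked-unique : ∀ B → Unique (keysFirstBlocked B)
  keysFirstBlocked-unique []      = []
  keysFirstBlocked-unique (_ ∷ _) = ((λ ()) ∷ []) ∷ [] ∷ []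
  false-vs-first : ∀ {k} → ¬ (k ∈ closingKeys false F × k ∈ keysFirstBlocked B)
  false-vs-first (p , q) with ∈-closingKeys⁻ p
  ... | x , x∈F , refl , refl = keysFirstBlocked-avoids increasing q x∈F
  true-vs-rest : ∀ {k} → ¬ (k ∈ closingKeys true F × k ∈ closingKeys false F ++ keysFirstBlocked B)
  true-vs-rest (p , q) with ∈-closingKeys⁻ p
  ... | x , x∈F , refl , refl with ∈-++⁻ (closingKeys false F) q
  ...   | inj₁ r = case ∈-closingKeys⁻ r of λ { (_ , _ , _ , ()) }
  ...   | inj₂ r = keysFirstBlocked-avoids increasing r x∈F

Unique-map⁺-local : ∀ {A B C : Set} (f : A → B) (g : A → C) (xs : List A) → Unique (map g xs) →
  (∀ {x y} → x ∈ xs → y ∈ xs → f x ≡ f y → g x ≡ g y) → Unique (map f xs)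
Unique-map⁺-local f g []       _        _         = []
Unique-map⁺-local f g (x ∷ xs) (gx∉ ∷ u) reflects =
  All.tabulate fx∉ ∷ Unique-map⁺-local f g xs u (λ p q → reflects (there p) (there q))
  where
  fx∉ : ∀ {v} → v ∈ map f xs → f x ≢ v
  fx∉ p fx≡v with ∈-map⁻ f p
  ... | y , y∈xs , refl = All.lookup gx∉ (∈-map⁺ g y∈xs) (reflects (here refl) (there y∈xs) fx≡v)

child : ∀ {n} → Diagram n → Choice × State → Diagram (suc n) × State
child d ((c , o) , st) = extend d c o , st

children : ∀ {n} → Diagram n × State → List (Diagram (suc n) × State)
children {n} (d , (B , F)) = map (child d) (choices n B F)

-- Level n of the generating tree, each node carrying its diagram and the state it is labelled by.
enumerate : (n : ℕ) → List (Diagram n × State)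
enumerate zero    = (V.[] , [] , []) ∷ []
enumerate (suc n) = concatMap children (enumerate n)

Tracks-empty : Tracks {0} V.[] [] []
Tracks-empty = record
  { valid       = ((λ { _ _ (arcAt () _ _ _ _) }) , (λ { _ _ _ (arcAt () _ _ _ _) _ })) ,
                  (λ { (nesting₃ _ _ _ _ _ (arcAt () _ _ _ _) _ _) }) ,
                  (λ { (futureNesting₃ _ _ _ _ (semiAt () _ _) _ _) })
  ; increasing  = []
  ; listed⇒semi = λ ()
  ; semi⇒listed = λ { (semiAt () _ _) }
  ; blocked     = λ ()
  ; free        = λ ()
  }

∈-children⁻ : ∀ {n} (d : Diagram n) B F {d′ st} → (d′ , st) ∈ children (d , (B , F)) →
  ∃[ c ] ∃[ o ] d′ ≡ extend d c o × Move n B F c o (proj₁ st) (proj₂ st)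
∈-children⁻ {n} d B F p with ∈-map⁻ (child d) p
... | ((c , o) , _) , q , refl = c , o , refl , ∈-choices⁻ n B F q

enumerate-tracks : ∀ n {d B F} → (d , (B , F)) ∈ enumerate n → Tracks d B F
enumerate-tracks zero (here refl) = Tracks-empty
enumerate-tracks (suc n) p with find (∈-concatMap⁻ children {xs = enumerate n} p)
... | (d , (B , F)) , q , p′ with ∈-children⁻ d B F p′
...   | c , o , refl , move = Tracks-move (enumerate-tracks n q) move

enumerate-complete : ∀ n (d : Diagram n) → Valid d → ∃[ st ] (d , st) ∈ enumerate n
enumerate-complete zero    V.[] _     = _ , here refl
enumerate-complete (suc n) d    valid =
  (B′ , F′) , ∈-concatMap⁺ children {xs = enumerate n} (lose p d∈children)
  where
  open Decomposition (decompose d (proj₁ valid))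
  previous = enumerate-complete n (restrict d) (Valid-restrict d valid)
  B = proj₁ (proj₁ previous)
  F = proj₂ (proj₁ previous)
  p = proj₂ previous
  next = move-exists d valid (enumerate-tracks n p) closing opens closesIntoLast
  B′ = proj₁ next
  F′ = proj₁ (proj₂ next)
  d∈children : (d , (B′ , F′)) ∈ children (restrict d , (B , F))
  d∈children = subst (λ d′ → (d′ , (B′ , F′)) ∈ children (restrict d , (B , F))) rebuilds
                     (∈-map⁺ (child (restrict d)) (∈-choices⁺ (proj₂ (proj₂ next))))

restrict-children : ∀ {n} (d : Diagram n) B F → Tracks d B F → ∀ {d′} →
  d′ ∈ map proj₁ (children (d , (B , F))) → restrict d′ ≡ d
restrict-children d B F t p with ∈-map⁻ proj₁ p
... | (_ , st) , q , refl with ∈-children⁻ d B F q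
...   | c , o , refl , move = restrict-extend d c o (Move-closesSemi t move)

children-unique : ∀ {n} (d : Diagram n) B F → Tracks d B F → Unique (map proj₁ (children (d , (B , F))))
children-unique {n} d B F t =
  subst Unique (LP.map-∘ (choices n B F))
    (Unique-map⁺-local (proj₁ ∘ child d) proj₁ (choices n B F) (keys-choices-unique n B F (Tracks.increasing t))
      (λ p q eq → uncurry (cong₂ _,_) (extend-injective d (closesSemi p) (closesSemi q) eq)))
  where
  closesSemi : ∀ {c o B′ F′} → ((c , o) , (B′ , F′)) ∈ choices n B F → ClosesSemi d c
  closesSemi p = Move-closesSemi t (∈-choices⁻ n B F p)

-- Children of different nodes are different, as their restrictions are.
concatMap-children-unique : ∀ {n} (xs : List (Diagram n × State)) → Unique (map proj₁ xs) →
  (∀ {d B F} → (d , (B , F)) ∈ xs → Tracks d B F) → Unique (map proj₁ (concatMap children xs))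
concatMap-children-unique []                  _            _      = []
concatMap-children-unique ((d , (B , F)) ∷ xs) (d∉ ∷ unique) tracks =
  subst Unique (sym (LP.map-++ proj₁ (children (d , (B , F))) (concatMap children xs)))
    (UP.++⁺ (children-unique d B F (tracks (here refl)))
            (concatMap-children-unique xs unique (tracks ∘ there)) disjoint)
  where
  disjoint : ∀ {d′} → ¬ (d′ ∈ map proj₁ (children (d , (B , F))) × d′ ∈ map proj₁ (concatMap children xs))
  disjoint (p , q) with ∈-map⁻ proj₁ q
  ... | (_ , st) , q′ , refl with find (∈-concatMap⁻ children {xs = xs} q′)
  ...   | (e , (B′ , F′)) , e∈xs , r =
    All.lookup d∉ (∈-map⁺ proj₁ e∈xs)
      (trans (sym (restrict-children d B F (tracks (here refl)) p))
             (restrict-children e B′ F′ (tracks (there e∈xs)) (∈-map⁺ proj₁ r)))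

enumerate-unique : ∀ n → Unique (map proj₁ (enumerate n))
enumerate-unique zero    = [] ∷ []
enumerate-unique (suc n) = concatMap-children-unique (enumerate n) (enumerate-unique n) (enumerate-tracks n)

labels-concatMap-children : ∀ {n} (xs : List (Diagram n × State)) →
  map (label ∘ proj₂) (concatMap children xs) ≡ concatMap rule (map (label ∘ proj₂) xs)
labels-concatMap-children []                   = refl
labels-concatMap-children {n} ((d , (B , F)) ∷ xs) =
  trans (LP.map-++ (label ∘ proj₂) (children (d , (B , F))) (concatMap children xs))
        (cong₂ _++_ (trans (sym (LP.map-∘ (choices n B F))) (labels-choices n B F))
                    (labels-concatMap-children xs))

labels-enumerate : ∀ n → map (label ∘ proj₂) (enumerate n) ≡ levelLabels n
labels-enumerate zero    = refl
labels-enumerate (suc n) =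
  trans (labels-concatMap-children (enumerate n)) (cong (concatMap rule) (labels-enumerate n))

length-filter-map-⇔ : ∀ {A B C : Set} {P : B → Set} {Q : C → Set} (P? : Decidable P) (Q? : Decidable Q)
  (f : A → B) (g : A → C) (xs : List A) → (∀ {x} → x ∈ xs → P (f x) ⇔ Q (g x)) →
  length (filter P? (map f xs)) ≡ length (filter Q? (map g xs))
length-filter-map-⇔ P? Q? f g []       _   = refl
length-filter-map-⇔ P? Q? f g (x ∷ xs) P⇔Q with P? (f x) | Q? (g x)
... | yes _  | yes _  = cong suc (length-filter-map-⇔ P? Q? f g xs (P⇔Q ∘ there))
... | no  _  | no  _  = length-filter-map-⇔ P? Q? f g xs (P⇔Q ∘ there)
... | yes p  | no ¬q  = ⊥-elim (¬q (Equivalence.to   (P⇔Q (here refl)) p))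
... | no ¬p  | yes q  = ⊥-elim (¬p (Equivalence.from (P⇔Q (here refl)) q))

noSemiArcs? : ∀ {n} (d : Diagram n) → Dec (NoSemiArcs d)
noSemiArcs? d = FP.all? (λ a → ¬? (lookup d a ≟Out semi))

label≡00⇔empty : ∀ (B F : List ℕ) → (label (B , F) ≡ (0 , 0)) ⇔ (B ++ F ≡ [])
label≡00⇔empty []      []      = mk⇔ (λ _ → refl) (λ _ → refl)
label≡00⇔empty []      (_ ∷ _) = mk⇔ (λ ()) (λ ())
label≡00⇔empty (_ ∷ _) _       = mk⇔ (λ ()) (λ ())

NoSemiArcs⇔empty : ∀ {n} {d : Diagram n} {B F} → Tracks d B F → NoSemiArcs d ⇔ (B ++ F ≡ [])
NoSemiArcs⇔empty {d = d} {B} {F} t = mk⇔ (λ no-semi → nothing-listed (B ++ F) no-semi listed⇒semi) empty⇒none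
  where
  open Tracks t
  nothing-listed : ∀ xs → NoSemiArcs d → (∀ {x} → x ∈ xs → Semi d x) → xs ≡ []
  nothing-listed []      _    _      = refl
  nothing-listed (_ ∷ _) no-semi listed with listed (here refl)
  ... | semiAt a _ e = ⊥-elim (no-semi a e)
  empty⇒none : B ++ F ≡ [] → NoSemiArcs d
  empty⇒none empty a e with subst (toℕ a ∈_) empty (semi⇒listed (IsSemi⇒Semi e))
  ... | ()

∈-enumerate⇔InPi2 : ∀ n (d : Diagram n) → (d ∈ map proj₁ (enumerate n)) ⇔ InPi2 d
∈-enumerate⇔InPi2 n d = mk⇔ enumerated⇒InPi2 λ d∈Π →
  ∈-map⁺ proj₁ (proj₂ (enumerate-complete n d (InPi2⇒Valid d d∈Π)))
  where
  enumerated⇒InPi2 : d ∈ map proj₁ (enumerate n) → InPi2 d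
  enumerated⇒InPi2 p with ∈-map⁻ proj₁ p
  ... | _ , q , refl = Valid⇒InPi2 d (Tracks.valid (enumerate-tracks n q))

NoSemiArcs⇔label≡00 : ∀ {n} {d : Diagram n} {B F} → Tracks d B F → NoSemiArcs d ⇔ (label (B , F) ≡ (0 , 0))
NoSemiArcs⇔label≡00 {B = B} {F} t = ⇔.trans (NoSemiArcs⇔empty t) (⇔.sym (label≡00⇔empty B F))

∈-filter-enumerate⇔Is3NonnestingSetPartition : ∀ n (d : Diagram n) →
  (d ∈ filter noSemiArcs? (map proj₁ (enumerate n))) ⇔ Is3NonnestingSetPartition d
∈-filter-enumerate⇔Is3NonnestingSetPartition n d = mk⇔ to from
  where
  open Equivalence (∈-enumerate⇔InPi2 n d)
    renaming (to to enumerated⇒InPi2; from to InPi2⇒enumerated)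
  to : d ∈ filter noSemiArcs? (map proj₁ (enumerate n)) → Is3NonnestingSetPartition d
  to p with ∈-filter⁻ noSemiArcs? {xs = map proj₁ (enumerate n)} p
  ... | q , no-semi with enumerated⇒InPi2 q
  ...   | wf , no-nesting , _ = wf , no-semi , no-nesting
  from : Is3NonnestingSetPartition d → d ∈ filter noSemiArcs? (map proj₁ (enumerate n))
  from (wf , no-semi , no-nesting) =
    ∈-filter⁺ noSemiArcs? (InPi2⇒enumerated (wf , no-nesting , no-future)) no-semi
    where
    no-future : ¬ HasFuture3Nesting d
    no-future (i₁ , _ , _ , _ , _ , _ , _ , _ , _ , e , _) = no-semi i₁ e

theorem2 : (n : ℕ) →
    HasCard (InPi2 {n}) (nodesAtLevel n) ×
    HasCard (Is3NonnestingSetPartition {n}) (nodesLabel00AtLevel n)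
theorem2 n =
  (diagrams , enumerate-unique n , ∈-enumerate⇔InPi2 n , length-diagrams) ,
  (filter noSemiArcs? diagrams , APP.filter⁺ noSemiArcs? (enumerate-unique n) ,
   ∈-filter-enumerate⇔Is3NonnestingSetPartition n , length-partitions)
  where
  diagrams = map proj₁ (enumerate n)
  length-diagrams : length diagrams ≡ nodesAtLevel n
  length-diagrams = begin
    length (map proj₁ (enumerate n))          ≡⟨ LP.length-map proj₁ (enumerate n) ⟩
    length (enumerate n)                      ≡⟨ LP.length-map (label ∘ proj₂) (enumerate n) ⟨
    length (map (label ∘ proj₂) (enumerate n)) ≡⟨ cong length (labels-enumerate n) ⟩
    length (levelLabels n)                    ∎
    where open ≡-Reasoning
  is00? = λ l → PP.≡-dec ℕ._≟_ ℕ._≟_ l (0 , 0)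
  length-partitions : length (filter noSemiArcs? diagrams) ≡ nodesLabel00AtLevel n
  length-partitions = trans
    (length-filter-map-⇔ noSemiArcs? is00? proj₁ (label ∘ proj₂) (enumerate n)
                         (NoSemiArcs⇔label≡00 ∘ enumerate-tracks n))
    (cong (length ∘ filter is00?) (labels-enumerate n))
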